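{- Let $\mathcal{M}=(W,\le,N,V)$ be a coherent intuitionistic neighbourhood model and $\mathcal{M}^*$ the associated $\mathsf{IK}_2$-model. Then for all $\phi\in\mathcal{L}_{\Box\Diamond}$ and $w\in W$: $\mathcal{M},w\Vdash\phi$ if and only if $\mathcal{M}^*,w\Vdash\phi^t$.
   Context: $\mathcal{L}_{\Box\Diamond}$: formulas $\phi ::= p_i \mid \bot \mid \phi\wedge\phi \mid \phi\vee\phi \mid \phi\to\phi \mid \Box\phi\mid\Diamond\phi$; $\mathcal{L}_2$: formulas with modalities $\Box_N,\Diamond_N,\Box_{\ni},\Diamond_{\ni}$ instead. Translation $(-)^t$: identity on letters and $\bot$, commutes with $\wedge,\vee,\to$, $(\Box\phi)^t=\Diamond_N\Box_{\ni}\phi^t$, $(\Diamond\phi)^t=\Box_N\Diamond_{\ni}\phi^t$. Intuitionistic neighbourhood models: for a poset $(W,\le)$, an intuitionistic neighbourhood is a partial function $a:W\rightharpoonup\mathcal{P}(W)$ whose domain $\mathrm{dom}(a)$ is an upset. A model is $\mathcal{M}=(W,\le,N,V)$ with $N$ a set of intuitionistic neighbourhoods and $V$ mapping letters to upsets; $N_w=\{a\in N\mid w\in\mathrm{dom}(a)\}$. Truth: $w\Vdash p$ iff $w\in V(p)$; $\bot$ never; $\wedge,\vee$ pointwise; $w\Vdash\phi\to\psi$ iff for all $v\ge w$, $v\Vdash\phi$ implies $v\Vdash\psi$; $w\Vdash\Box\phi$ iff there is $a\in N_w$ such that for all $w'\ge w$ and all $v\in a(w')$, $v\Vdash\phi$;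 $w\Vdash\Diamond\phi$ iff for all $w'\ge w$ and all $a\in N_{w'}$ there is $v\in a(w')$ with $v\Vdash\phi$. $a$ is coherent if (N1) whenever $w\le w'$, $w\in\mathrm{dom}(a)$ and $v\in a(w)$, there is $v'\in a(w')$ with $v\le v'$; (N2) whenever $v\in a(w)$ and $v\le v'$, there is $w'\ge w$ with $v'\in a(w')$. $\mathcal{M}$ is coherent if all its neighbourhoods are. $\mathsf{IK}_2$-models: $(X,\le,R_N,R_{\ni},V)$ with $\le$ a preorder, $R_N,R_{\ni}$ binary relations on $X$ such that for $j\in\{N,\ni\}$: if $w\le v$ and $wR_ju$ then there is $x$ with $vR_jx$ and $u\le x$; if $wR_ju$ and $u\le x$ then there is $v$ with $w\le v$ and $vR_jx$; $V$ maps letters to upsets. Truth: usual intuitionistic clauses; $x\Vdash\Box_j\psi$ iff for all $y,z$ with $x\le y$ and $yR_jz$, $z\Vdash\psi$; $x\Vdash\Diamond_j\psi$ iff there is $y$ with $xR_jy$ and $y\Vdash\psi$. The model $\mathcal{M}^*$: $N(W)=\{(a,w)\mid a\in N, w\in\mathrm{dom}(a)\}$ ordered by $(a,w)\sqsubset(b,v)$ iff $a=b$ and $w\le v$; $W^*=W\sqcup N(W)$ with order $\le^*$ the union of $\le$ and $\sqsubset$; $wR_N(a,v)$ iff $w=v$ (for $w\in W$, $(a,v)\in N(W)$); $(a,w)R_{\ni}v$ iff $v\in a(w)$ (for $v\in W$); valuation $V$ (so no element of $N(W)$ satisfies a letter). $\mathcal{M}^*=(W^*,\le^*,R_N,R_{\ni},V)$;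 when $\mathcal{M}$ is coherent this is an $\mathsf{IK}_2$-model. -}

module Defs where

open import Data.Nat using (ℕ)
open import Data.Product using (Σ; ∃; _×_; _,_)
open import Data.Sum using (_⊎_; inj₁; inj₂)
open import Data.Empty using (⊥)
open import Relation.Binary.PropositionalEquality using (_≡_)
open import Relation.Binary.Structures using (IsPartialOrder)

data Form : Set where
  var  : ℕ → Form
  ⊥'   : Form
  _∧'_ : Form → Form → Form
  _∨'_ : Form → Form → Form
  _⇒_  : Form → Form → Form
  □_   : Form → Form
  ◇_   : Form → Form

data Form2 : Set where
  var  : ℕ → Form2
  ⊥'   : Form2
  _∧'_ : Form2 → Form2 → Form2
  _∨'_ : Form2 → Form2 → Form2
  _⇒_  : Form2 → Form2 → Form2
  □N_  : Form2 → Form2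
  ◇N_  : Form2 → Form2
  □∋_  : Form2 → Form2
  ◇∋_  : Form2 → Form2

_ᵗ : Form → Form2
var i ᵗ   = var i
⊥' ᵗ      = ⊥'
(φ ∧' ψ) ᵗ = (φ ᵗ) ∧' (ψ ᵗ)
(φ ∨' ψ) ᵗ = (φ ᵗ) ∨' (ψ ᵗ)
(φ ⇒ ψ) ᵗ  = (φ ᵗ) ⇒ (ψ ᵗ)
(□ φ) ᵗ   = ◇N (□∋ (φ ᵗ))
(◇ φ) ᵗ   = □N (◇∋ (φ ᵗ))

-- An intuitionistic neighbourhood on a poset (W, ≤): a partial function
-- a : W ⇀ P(W) whose domain is an upset.  The value a(w) is given by the
-- predicate `app w`; it is only ever consulted for w ∈ dom.
record Nbhd (W : Set) (_≤_ : W → W → Set) : Set₁ where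
  field
    dom    : W → Set
    dom-up : ∀ {w v} → w ≤ v → dom w → dom v
    app    : W → W → Set     -- app w v  means  v ∈ a(w)

record NModel : Set₁ where
  field
    W        : Set
    _≤_      : W → W → Set
    isPO     : IsPartialOrder _≡_ _≤_
    -- the set N of neighbourhoods, given as an indexed family
    I        : Set
    nb       : I → Nbhd W _≤_
    V        : ℕ → W → Set
    V-up     : ∀ i {w v} → w ≤ v → V i w → V i v

module _ (M : NModel) where
  open NModel M
  open Nbhd

  Coherent-nb : Nbhd W _≤_ → Set
  Coherent-nb a =
    (∀ {w w' v} → w ≤ w' → dom a w → app a w v → ∃ λ v' → app a w' v' × v ≤ v')
    × (∀ {w v v'} → dom a w → app a w v → v ≤ v' → ∃ λ w' → w ≤ w' × app a w' v')

  Coherent : Set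
  Coherent = ∀ i → Coherent-nb (nb i)

  _⊩_ : W → Form → Set
  w ⊩ var i   = V i w
  w ⊩ ⊥'      = ⊥
  w ⊩ (φ ∧' ψ) = (w ⊩ φ) × (w ⊩ ψ)
  w ⊩ (φ ∨' ψ) = (w ⊩ φ) ⊎ (w ⊩ ψ)
  w ⊩ (φ ⇒ ψ)  = ∀ v → w ≤ v → v ⊩ φ → v ⊩ ψ
  w ⊩ (□ φ)   = Σ I λ a → dom (nb a) w ×
                  (∀ w' → w ≤ w' → ∀ v → app (nb a) w' v → v ⊩ φ)
  w ⊩ (◇ φ)   = ∀ w' → w ≤ w' → ∀ a → dom (nb a) w' →
                  Σ W λ v → app (nb a) w' v × v ⊩ φ

record BiModel : Set₁ where
  field
    X   : Set
    _≤_ : X → X → Set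
    RN  : X → X → Set
    R∋  : X → X → Set
    V   : ℕ → X → Set

module _ (K : BiModel) where
  open BiModel K

  _⊩₂_ : X → Form2 → Set
  x ⊩₂ var i    = V i x
  x ⊩₂ ⊥'       = ⊥
  x ⊩₂ (φ ∧' ψ) = (x ⊩₂ φ) × (x ⊩₂ ψ)
  x ⊩₂ (φ ∨' ψ) = (x ⊩₂ φ) ⊎ (x ⊩₂ ψ)
  x ⊩₂ (φ ⇒ ψ)  = ∀ y → x ≤ y → y ⊩₂ φ → y ⊩₂ ψ
  x ⊩₂ (□N φ)   = ∀ y z → x ≤ y → RN y z → z ⊩₂ φ
  x ⊩₂ (◇N φ)   = Σ X λ y → RN x y × y ⊩₂ φ
  x ⊩₂ (□∋ φ)   = ∀ y z → x ≤ y → R∋ y z → z ⊩₂ φ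
  x ⊩₂ (◇∋ φ)   = Σ X λ y → R∋ x y × y ⊩₂ φ

-- IK_2 frame conditions (for reference; M* satisfies them when M is coherent)
IK2-conditions : BiModel → Set
IK2-conditions K = F RN × F R∋
  where
    open BiModel K
    F : (X → X → Set) → Set
    F R = (∀ {w v u} → w ≤ v → R w u → ∃ λ x → R v x × u ≤ x)
        × (∀ {w u x} → R w u → u ≤ x → ∃ λ v → w ≤ v × R v x)

module Star (M : NModel) where
  open NModel M
  open Nbhd

  NW : Set
  NW = Σ I λ a → Σ W λ w → dom (nb a) w

  W* : Set
  W* = W ⊎ NW

  data _≤*_ : W* → W* → Set where
    inW : ∀ {w v} → w ≤ v → inj₁ w ≤* inj₁ v
    inN : ∀ {a b w v p q} → a ≡ b → w ≤ v → inj₂ (a , w , p) ≤* inj₂ (b , v , q)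

  R-N : W* → W* → Set
  R-N (inj₁ w) (inj₂ (a , v , p)) = w ≡ v
  R-N _ _ = ⊥

  R-∋ : W* → W* → Set
  R-∋ (inj₂ (a , w , p)) (inj₁ v) = app (nb a) w v
  R-∋ _ _ = ⊥

  V* : ℕ → W* → Set
  V* i (inj₁ w) = V i w
  V* i (inj₂ _) = ⊥

  model : BiModel
  model = record { X = W* ; _≤_ = _≤*_ ; RN = R-N ; R∋ = R-∋ ; V = V* }

_* : NModel → BiModel
M * = Star.model M

{-# OPTIONS --safe #-}
module Submission where

open import Defs
open import Data.Sum using (inj₁; inj₂)
open import Data.Product using (_×_; _,_; Σ)
open import Relation.Binary.PropositionalEquality using (refl)

-- The node (a , w) of M* stands for "the neighbourhood a, chosen at w"; its
-- ≤*-successors are the nodes (a , w') with w ≤ w', and its R∋-successors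
-- are the points of a(w).  Hence ◇N □∋ in M* says exactly "some a ∈ N_w has
-- all of its later values inside the truth set", which is the neighbourhood
-- clause for □, and dually □N ◇∋ is the clause for ◇.

module Translation (M : NModel) where
  open NModel M
  open Nbhd
  open Star M

  _⊩ᴹ_ : W → Form → Set
  _⊩ᴹ_ = _⊩_ M

  _⊩*_ : W* → Form2 → Set
  _⊩*_ = _⊩₂_ (M *)

  □ᴺ : (W → Set) → W → Set
  □ᴺ P w = Σ I λ a → dom (nb a) w × (∀ w' → w ≤ w' → ∀ v → app (nb a) w' v → P v)

  ◇ᴺ : (W → Set) → W → Set
  ◇ᴺ P w = ∀ w' → w ≤ w' → ∀ a → dom (nb a) w' → Σ W λ v → app (nb a) w' v × P v

  □ᴺ-mono : ∀ {P Q : W → Set} → (∀ v → P v → Q v) → ∀ w → □ᴺ P w → □ᴺ Q w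
  □ᴺ-mono P⇒Q w (a , w∈dom , a⊆P) = a , w∈dom , λ w' w≤w' v v∈a → P⇒Q v (a⊆P w' w≤w' v v∈a)

  ◇ᴺ-mono : ∀ {P Q : W → Set} → (∀ v → P v → Q v) → ∀ w → ◇ᴺ P w → ◇ᴺ Q w
  ◇ᴺ-mono P⇒Q w meets w' w≤w' a w'∈dom with meets w' w≤w' a w'∈dom
  ... | v , v∈a , Pv = v , v∈a , P⇒Q v Pv

  □ᴺ⇒◇N□∋ : ∀ ψ w → □ᴺ (λ v → inj₁ v ⊩* ψ) w → inj₁ w ⊩* (◇N □∋ ψ)
  □ᴺ⇒◇N□∋ ψ w (a , w∈dom , a⊆ψ) = inj₂ (a , w , w∈dom) , refl , a⊆ψ*
    where
    a⊆ψ* : inj₂ (a , w , w∈dom) ⊩* (□∋ ψ)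
    a⊆ψ* (inj₂ (.a , w' , _)) (inj₁ v) (inN refl w≤w') v∈a = a⊆ψ w' w≤w' v v∈a

  ◇N□∋⇒□ᴺ : ∀ ψ w → inj₁ w ⊩* (◇N □∋ ψ) → □ᴺ (λ v → inj₁ v ⊩* ψ) w
  ◇N□∋⇒□ᴺ ψ w (inj₂ (a , .w , w∈dom) , refl , a⊆ψ*) =
    a , w∈dom , λ w' w≤w' v v∈a →
      a⊆ψ* (inj₂ (a , w' , dom-up (nb a) w≤w' w∈dom)) (inj₁ v) (inN refl w≤w') v∈a

  ◇ᴺ⇒□N◇∋ : ∀ ψ w → ◇ᴺ (λ v → inj₁ v ⊩* ψ) w → inj₁ w ⊩* (□N ◇∋ ψ)
  ◇ᴺ⇒□N◇∋ ψ w meets (inj₁ w') (inj₂ (a , .w' , w'∈dom)) (inW w≤w') refl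
    with meets w' w≤w' a w'∈dom
  ... | v , v∈a , ψv = inj₁ v , v∈a , ψv

  □N◇∋⇒◇ᴺ : ∀ ψ w → inj₁ w ⊩* (□N ◇∋ ψ) → ◇ᴺ (λ v → inj₁ v ⊩* ψ) w
  □N◇∋⇒◇ᴺ ψ w meets* w' w≤w' a w'∈dom
    with meets* (inj₁ w') (inj₂ (a , w' , w'∈dom)) (inW w≤w') refl
  ... | inj₁ v , v∈a , ψv = v , v∈a , ψv

  ⊩⇒⊩ᵗ : ∀ φ w → w ⊩ᴹ φ → inj₁ w ⊩* (φ ᵗ)
  ⊩ᵗ⇒⊩ : ∀ φ w → inj₁ w ⊩* (φ ᵗ) → w ⊩ᴹ φ

  ⊩⇒⊩ᵗ (var i) w p = p
  ⊩⇒⊩ᵗ (φ ∧' ψ) w (φw , ψw) = ⊩⇒⊩ᵗ φ w φw , ⊩⇒⊩ᵗ ψ w ψw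
  ⊩⇒⊩ᵗ (φ ∨' ψ) w (inj₁ φw) = inj₁ (⊩⇒⊩ᵗ φ w φw)
  ⊩⇒⊩ᵗ (φ ∨' ψ) w (inj₂ ψw) = inj₂ (⊩⇒⊩ᵗ ψ w ψw)
  ⊩⇒⊩ᵗ (φ ⇒ ψ) w φ→ψ (inj₁ v) (inW w≤v) φv = ⊩⇒⊩ᵗ ψ v (φ→ψ v w≤v (⊩ᵗ⇒⊩ φ v φv))
  ⊩⇒⊩ᵗ (□ φ) w □φ = □ᴺ⇒◇N□∋ (φ ᵗ) w (□ᴺ-mono (⊩⇒⊩ᵗ φ) w □φ)
  ⊩⇒⊩ᵗ (◇ φ) w ◇φ = ◇ᴺ⇒□N◇∋ (φ ᵗ) w (◇ᴺ-mono (⊩⇒⊩ᵗ φ) w ◇φ)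

  ⊩ᵗ⇒⊩ (var i) w p = p
  ⊩ᵗ⇒⊩ (φ ∧' ψ) w (φw , ψw) = ⊩ᵗ⇒⊩ φ w φw , ⊩ᵗ⇒⊩ ψ w ψw
  ⊩ᵗ⇒⊩ (φ ∨' ψ) w (inj₁ φw) = inj₁ (⊩ᵗ⇒⊩ φ w φw)
  ⊩ᵗ⇒⊩ (φ ∨' ψ) w (inj₂ ψw) = inj₂ (⊩ᵗ⇒⊩ ψ w ψw)
  ⊩ᵗ⇒⊩ (φ ⇒ ψ) w φ→ψ v w≤v φv = ⊩ᵗ⇒⊩ ψ v (φ→ψ (inj₁ v) (inW w≤v) (⊩⇒⊩ᵗ φ v φv))
  ⊩ᵗ⇒⊩ (□ φ) w □φ = □ᴺ-mono (⊩ᵗ⇒⊩ φ) w (◇N□∋⇒□ᴺ (φ ᵗ) w □φ)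
  ⊩ᵗ⇒⊩ (◇ φ) w ◇φ = ◇ᴺ-mono (⊩ᵗ⇒⊩ φ) w (□N◇∋⇒◇ᴺ (φ ᵗ) w ◇φ)

open Translation using (⊩⇒⊩ᵗ; ⊩ᵗ⇒⊩)

-- Coherence is what makes M* an IK₂-model; the truth correspondence itself
-- holds for every neighbourhood model.
proposition4p18 : (M : NModel) → Coherent M →
    ∀ (φ : Form) (w : NModel.W M) →
      ((_⊩_ M w φ → _⊩₂_ (M *) (inj₁ w) (φ ᵗ)) × (_⊩₂_ (M *) (inj₁ w) (φ ᵗ) → _⊩_ M w φ))
proposition4p18 M _ φ w = ⊩⇒⊩ᵗ M φ w , ⊩ᵗ⇒⊩ M φ w
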